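{- Let $k\ge 2$ and let $n$ be a positive multiple of $k$. Let $v_1,\ldots,v_{2n}$ be points in convex position labeled in clockwise order, partitioned into the $2n/k$ blocks $B_i=\{v_{(i-1)k+1},\ldots,v_{ik}\}$, $1\le i\le 2n/k$, and colored with colors $c_1,\ldots,c_k$ so that the vertex $v_{(i-1)k+r}$ ($1\le r\le k$) gets color $c_r$ if $i$ is odd and color $c_{k+1-r}$ if $i$ is even. Let $M$ be a plane perfect matching on $v_1,\ldots,v_{2n}$ with valid block structure that is not a $k$-colored matching. Then $M$ contains an edge $v_sv_e$ with $s<e$ having the following properties: (i) $v_s$ and $v_e$ lie in different blocks, say $v_s\in S$ and $v_e\in E$; (ii) there is no edge of $M$ joining two vertices of different colors with both endpoints among $v_{s+1},\ldots,v_{e-1}$; (iii) the number of blocks strictly between $S$ and $E$ is odd; (iv) if $v_s$ is the $j$-th vertex of $S$ (in increasing index order), then $v_e$ is the $(j+1)$-st vertex of $E$.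
   Context: A plane perfect matching on points in convex position is a set of pairwise non-crossing straight-line segments between the points such that each point is an endpoint of exactly one segment. Each edge $v_av_b$ with $a<b$ is regarded as directed from $v_a$ to $v_b$; $v_a$ has outdegree $1$ and $v_b$ has outdegree $0$. The matching has a valid block structure if within every block, no vertex of outdegree $1$ has smaller index than a vertex of outdegree $0$ (i.e. the outdegrees within each block read $0,\ldots,0,1,\ldots,1$ in index order, either part possibly empty). A $k$-colored matching is a plane perfect matching in which every edge joins two vertices of the same color. -}

module Defs where

open import Data.Nat using (ℕ; zero; suc; _+_; _*_; _∸_; _<_; _≤_; NonZero; _≡ᵇ_)
open import Data.Nat.DivMod using (_/_; _%_)
open import Data.Fin using (Fin; toℕ)
open import Data.Bool using (if_then_else_)
open import Data.Product using (_×_; Σ; ∃; _,_)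
open import Relation.Binary.PropositionalEquality using (_≡_; _≢_)
open import Relation.Nullary using (¬_)

-- Vertices v_1,…,v_{2n} are represented 0-indexed by Fin (2 * n):
-- vertex index i (0-based) stands for v_{i+1}.  Since the points are in
-- convex position and labelled in (clockwise) order, two chords cross iff
-- their endpoints interleave in index order.

record PerfectMatching (N : ℕ) : Set where
  field
    partner     : Fin N → Fin N
    involutive  : ∀ v → partner (partner v) ≡ v
    no-fixpoint : ∀ v → partner v ≢ v
open PerfectMatching public

-- v has outdegree 1 (it is the smaller endpoint of its edge).
Out1 : ∀ {N} → PerfectMatching N → Fin N → Set
Out1 M v = toℕ v < toℕ (partner M v)

Plane : ∀ {N} → PerfectMatching N → Set
Plane M = ∀ a c → Out1 M a → Out1 M c →
  ¬ (toℕ a < toℕ c × toℕ c < toℕ (partner M a) × toℕ (partner M a) < toℕ (partner M c))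

-- Block of a (0-based) vertex index: blocks have size k; block number is 0-based
-- (0-based block b corresponds to B_{b+1}).
block : (k : ℕ) .{{_ : NonZero k}} → ℕ → ℕ
block k v = v / k

-- 0-based position of a vertex inside its block (position r-1 for v_{(i-1)k+r}).
pos : (k : ℕ) .{{_ : NonZero k}} → ℕ → ℕ
pos k v = v % k

-- Colour (0-based: colour c means c_{c+1}).  In B_i with i odd (0-based block
-- even) v_{(i-1)k+r} gets c_r; with i even it gets c_{k+1-r}.
colour : (k : ℕ) .{{_ : NonZero k}} → ℕ → ℕ
colour k v = if (block k v % 2) ≡ᵇ 0 then pos k v else k ∸ 1 ∸ pos k v

ValidBlockStructure : ∀ {N} (k : ℕ) .{{_ : NonZero k}} → PerfectMatching N → Set
ValidBlockStructure k M = ∀ u v → block k (toℕ u) ≡ block k (toℕ v) →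
  toℕ u < toℕ v → Out1 M u → Out1 M v

KColoured : ∀ {N} (k : ℕ) .{{_ : NonZero k}} → PerfectMatching N → Set
KColoured k M = ∀ v → colour k (toℕ v) ≡ colour k (toℕ (partner M v))

Odd : ℕ → Set
Odd m = ∃ λ t → m ≡ suc (2 * t)

module Submission where

-- Starting from any edge joining two colours, pass to a bichromatic edge nested inside it as long as
-- one exists; this ends at a bichromatic edge v_s v_e inside which all edges are monochromatic. By
-- planarity the vertices strictly between v_s and v_e are matched among themselves, so every colour
-- occurs an even number of times there. On the other hand, the colours occurring an odd number of
-- times among v_1, ..., v_x always form an initial segment c_1, ..., c_L, with L = r inside an odd
-- block after its r-th vertex and L = k - r inside an even one. Equating L just after v_s and just
-- before v_e, together with colour v_s ≠ colour v_e, forces the blocks of v_s and v_e to have the same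
-- parity and pos v_e = pos v_s + 1; the blocks differ by the valid block structure.

open import Defs
open import Data.Nat
  using (ℕ; zero; suc; _+_; _*_; _∸_; _<_; _≤_; NonZero; pred; _≡ᵇ_; _<ᵇ_; s≤s; _<?_; _≟_)
open import Data.Nat.Properties
  using ( <-cmp; <-irrefl; <-asym; <-trans; <-≤-trans; <⇒≤; ≤-refl; n<1+n; m≤n⇒m<n∨m≡n; ≤∧≢⇒<
        ; ∸-monoʳ-<; ∸-monoˡ-≤; ∸-cancelˡ-≡; ∸-+-assoc; pred[m∸n]≡m∸[1+n]; n∸n≡0; *-distribˡ-+)
open import Data.Nat.DivMod
  using ( _/_; _%_; m≡m%n+[m/n]*n; m%n<n; [m+kn]%n≡m%n; m<n⇒m%n≡m; +-distrib-/-∣ʳ; m<n⇒m/n≡0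
        ; m*n/n≡m; /-monoˡ-≤)
open import Data.Nat.Divisibility using (_∣_; n∣m*n)
open import Data.Nat.Induction using (<-wellFounded)
open import Data.Fin using (Fin; toℕ; fromℕ<)
open import Data.Fin.Properties using (toℕ-injective; toℕ<n; toℕ-fromℕ<; any?; ¬∀⟶∃¬)
open import Data.Bool using (Bool; true; false; not; _xor_; if_then_else_)
open import Data.Bool.Properties using (xor-assoc; xor-same; xor-identityʳ; not-injective)
open import Data.Product using (_×_; _,_; Σ-syntax)
open import Data.Sum using (inj₁; inj₂)
open import Data.Unit using (⊤; tt)
open import Data.Empty using (⊥-elim)
open import Function using (_∘_)
open import Induction.WellFounded using (Acc; acc)
open import Relation.Binary using (tri<; tri≈; tri>)
open import Relation.Binary.PropositionalEquality
  using (_≡_; _≢_; refl; sym; trans; cong; cong₂; subst; module ≡-Reasoning)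
open import Relation.Nullary using (¬_; Dec; yes; no)
open import Relation.Nullary.Decidable using (_×-dec_; ¬?; decidable-stable)

evenᵇ : ℕ → Bool
evenᵇ n = n % 2 ≡ᵇ 0

evenᵇ-suc : ∀ n → evenᵇ (suc n) ≡ not (evenᵇ n)
evenᵇ-suc zero = refl
evenᵇ-suc (suc zero) = refl
evenᵇ-suc (suc (suc n)) = evenᵇ-suc n

odd-if-suc-even : ∀ n → evenᵇ (suc n) ≡ true → Odd n
odd-if-suc-even zero ()
odd-if-suc-even (suc zero) _ = 0 , refl
odd-if-suc-even (suc (suc n)) even with odd-if-suc-even n even
... | t , n≡1+2t = suc t , trans (cong (suc ∘ suc) n≡1+2t) (cong suc (sym (*-distribˡ-+ 2 1 t)))

odd-gap : ∀ {a b} → a < b → evenᵇ a ≡ evenᵇ b → Odd (b ∸ a ∸ 1)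
odd-gap {zero} {suc b} _ same = odd-if-suc-even b (sym same)
odd-gap {suc a} {suc b} (s≤s a<b) same =
  odd-gap a<b (not-injective (trans (sym (evenᵇ-suc a)) (trans same (evenᵇ-suc b))))

xor-cancelʳ : ∀ x y → (x xor y) xor y ≡ x
xor-cancelʳ x y = trans (xor-assoc x y y) (trans (cong (x xor_) (xor-same y)) (xor-identityʳ x))

<ᵇ-suc : ∀ c m → (c <ᵇ suc m) ≡ (c <ᵇ m) xor (m ≡ᵇ c)
<ᵇ-suc zero zero = refl
<ᵇ-suc zero (suc m) = refl
<ᵇ-suc (suc c) zero = refl
<ᵇ-suc (suc c) (suc m) = <ᵇ-suc c m

<ᵇ-injective : ∀ {m n} → (∀ c → (c <ᵇ m) ≡ (c <ᵇ n)) → m ≡ n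
<ᵇ-injective {zero} {zero} _ = refl
<ᵇ-injective {zero} {suc n} agree with agree 0
... | ()
<ᵇ-injective {suc m} {zero} agree with agree 0
... | ()
<ᵇ-injective {suc m} {suc n} agree = cong suc (<ᵇ-injective (agree ∘ suc))

∸-suc : ∀ {p k} → p < k → k ∸ p ≡ suc (k ∸ suc p)
∸-suc {zero} {suc k} _ = refl
∸-suc {suc p} {suc k} (s≤s p<k) = ∸-suc p<k

∸-mono-< : ∀ {a b c d} → a < c → d ≤ b → c ≤ d → d ∸ c < b ∸ a
∸-mono-< {a} a<c d≤b c≤d = <-≤-trans (∸-monoʳ-< a<c c≤d) (∸-monoˡ-≤ a d≤b)

oddCountᵇ : (ℕ → ℕ) → ℕ → ℕ → Bool
oddCountᵇ col c zero = false
oddCountᵇ col c (suc x) = oddCountᵇ col c x xor (col x ≡ᵇ c)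

module PlaneMatching {N : ℕ} (M : PerfectMatching N) (plane : Plane M) where

  private
    p : Fin N → Fin N
    p = partner M

  partner-swap : ∀ {x y} → x ≡ p y → p x ≡ y
  partner-swap {y = y} refl = involutive M y

  partner-injective : ∀ {x y} → p x ≡ p y → x ≡ y
  partner-injective {x} {y} px≡py = trans (sym (involutive M x)) (partner-swap px≡py)

  nested : ∀ {a x} → Out1 M a → toℕ a < toℕ x → toℕ x < toℕ (p a) →
           toℕ a < toℕ (p x) × toℕ (p x) < toℕ (p a)
  nested {a} {x} a<pa a<x x<pa = after-a , before-pa
    where
    x<ppx : toℕ (p x) < toℕ a → Out1 M (p x)
    x<ppx px<a = subst (λ y → toℕ (p x) < toℕ y) (sym (involutive M x)) (<-trans px<a a<x)

    after-a : toℕ a < toℕ (p x)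
    after-a with <-cmp (toℕ a) (toℕ (p x))
    ... | tri< a<px _ _ = a<px
    ... | tri≈ _ a≡px _ =
      ⊥-elim (<-irrefl (cong toℕ (sym (partner-swap (toℕ-injective a≡px)))) x<pa)
    ... | tri> _ _ px<a = ⊥-elim (plane (p x) a (x<ppx px<a) a<pa (px<a ,
      subst (λ y → toℕ a < toℕ y × toℕ y < toℕ (p a)) (sym (involutive M x)) (a<x , x<pa)))

    before-pa : toℕ (p x) < toℕ (p a)
    before-pa with <-cmp (toℕ (p x)) (toℕ (p a))
    ... | tri< px<pa _ _ = px<pa
    ... | tri≈ _ px≡pa _ =
      ⊥-elim (<-irrefl (cong toℕ (sym (partner-injective (toℕ-injective px≡pa)))) a<x)
    ... | tri> _ _ pa<px = ⊥-elim (plane a x a<pa (<-trans x<pa pa<px) (a<x , x<pa , pa<px))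

  module Colouring (col : ℕ → ℕ) where

    Monochromatic : Fin N → Set
    Monochromatic x = col (toℕ x) ≡ col (toℕ (p x))

    monochromatic? : ∀ x → Dec (Monochromatic x)
    monochromatic? x = col (toℕ x) ≟ col (toℕ (p x))

    monochromatic-partner : ∀ {x} → Monochromatic (p x) → Monochromatic x
    monochromatic-partner {x} mono =
      sym (subst (λ y → col (toℕ (p x)) ≡ col (toℕ y)) (involutive M x) mono)

    ClosedMonochromatic : ℕ → ℕ → Set
    ClosedMonochromatic a b = ∀ x → a ≤ toℕ x → toℕ x < b →
      a ≤ toℕ (p x) × toℕ (p x) < b × Monochromatic x

    -- Split [a, b) at the partner q of a into [a+1, q) and [q+1, b); planarity keeps both closed.
    oddCountᵇ-closed : ∀ c {a b} → Acc _<_ (b ∸ a) → a ≤ b → b ≤ N → ClosedMonochromatic a b →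
                       oddCountᵇ col c a ≡ oddCountᵇ col c b
    oddCountᵇ-closed c _ a≤b b≤N closed with m≤n⇒m<n∨m≡n a≤b
    ... | inj₂ a≡b = cong (oddCountᵇ col c) a≡b
    ... | inj₁ a<b with fromℕ< (<-≤-trans a<b b≤N) | toℕ-fromℕ< (<-≤-trans a<b b≤N)
    oddCountᵇ-closed c {b = b} (acc shorter) a≤b b≤N closed | inj₁ a<b | A | refl
      with closed A ≤-refl a<b
    ... | A≤q , q<b , mono = begin
      oddCountᵇ col c (toℕ A)              ≡⟨ sym (xor-cancelʳ _ _) ⟩
      oddCountᵇ col c (suc (toℕ A)) xor t  ≡⟨ cong (_xor t) left ⟩
      oddCountᵇ col c q xor t              ≡⟨ cong (λ u → oddCountᵇ col c q xor (u ≡ᵇ c)) mono ⟩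
      oddCountᵇ col c (suc q)              ≡⟨ right ⟩
      oddCountᵇ col c b                    ∎
      where
      open ≡-Reasoning
      q : ℕ
      q = toℕ (p A)

      t : Bool
      t = col (toℕ A) ≡ᵇ c

      A<q : Out1 M A
      A<q with m≤n⇒m<n∨m≡n A≤q
      ... | inj₁ A<q = A<q
      ... | inj₂ A≡q = ⊥-elim (no-fixpoint M A (sym (toℕ-injective A≡q)))

      inner : ClosedMonochromatic (suc (toℕ A)) q
      inner x A<x x<q with nested A<q A<x x<q | closed x (<⇒≤ A<x) (<-trans x<q q<b)
      ... | A<px , px<q | _ , _ , mono-x = A<px , px<q , mono-x

      outer : ClosedMonochromatic (suc q) b
      outer x q<x x<b with closed x (<⇒≤ (<-≤-trans A<q (<⇒≤ q<x))) x<b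
      ... | A≤px , px<b , mono-x = q<px , px<b , mono-x
        where
        q<px : q < toℕ (p x)
        q<px with <-cmp q (toℕ (p x)) | m≤n⇒m<n∨m≡n A≤px
        ... | tri< q<px _ _ | _ = q<px
        ... | tri≈ _ q≡px _ | _ = ⊥-elim
          (<-irrefl (cong toℕ (partner-injective (toℕ-injective q≡px))) (<-trans A<q q<x))
        ... | tri> _ _ px<q | inj₂ A≡px = ⊥-elim
          (<-irrefl (cong toℕ (partner-swap (toℕ-injective A≡px))) q<x)
        ... | tri> _ _ px<q | inj₁ A<px with nested A<q A<px px<q
        ...   | _ , x<q = ⊥-elim (<-asym q<x (subst (λ y → toℕ y < q) (involutive M x) x<q))

      left : oddCountᵇ col c (suc (toℕ A)) ≡ oddCountᵇ col c q
      left = oddCountᵇ-closed c (shorter (∸-mono-< (n<1+n _) (<⇒≤ q<b) A<q))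
                              A<q (<⇒≤ (toℕ<n (p A))) inner

      right : oddCountᵇ col c (suc q) ≡ oddCountᵇ col c b
      right = oddCountᵇ-closed c (shorter (∸-mono-< (s≤s A≤q) ≤-refl q<b)) q<b b≤N outer

    MixedEdge : Fin N → Set
    MixedEdge s = Out1 M s × ¬ Monochromatic s

    MonochromaticInside : Fin N → Set
    MonochromaticInside s = ∀ x → toℕ s < toℕ x → toℕ x < toℕ (p s) → Monochromatic x

    Inside : Fin N → Fin N → Set
    Inside s x = toℕ s < toℕ x × toℕ x < toℕ (p s)

    orient : (P : Fin N → Set) → ∀ v → ¬ Monochromatic v → P v → P (p v) →
             Σ[ s ∈ Fin N ] MixedEdge s × P s × P (p s)
    orient P v mixed Pv Ppv with <-cmp (toℕ v) (toℕ (p v))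
    ... | tri< v<pv _ _ = v , (v<pv , mixed) , Pv , Ppv
    ... | tri≈ _ v≡pv _ = ⊥-elim (no-fixpoint M v (sym (toℕ-injective v≡pv)))
    ... | tri> _ _ pv<v =
      p v , (pv<ppv , mixed ∘ monochromatic-partner) , Ppv , subst P (sym (involutive M v)) Pv
      where
      pv<ppv : toℕ (p v) < toℕ (p (p v))
      pv<ppv = subst (λ y → toℕ (p v) < toℕ y) (sym (involutive M v)) pv<v

    innermost : ∀ s → Acc _<_ (toℕ (p s) ∸ toℕ s) → MixedEdge s →
                Σ[ t ∈ Fin N ] MixedEdge t × MonochromaticInside t
    innermost s (acc shorter) edge@(s<ps , _)
      with any? (λ x → ((toℕ s <? toℕ x) ×-dec (toℕ x <? toℕ (p s))) ×-dec ¬? (monochromatic? x))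
    ... | no none = s , edge , λ x s<x x<ps →
      decidable-stable (monochromatic? x) (λ mixed → none (x , (s<x , x<ps) , mixed))
    ... | yes (x , (s<x , x<ps) , mixed)
      with orient (Inside s) x mixed (s<x , x<ps) (nested s<ps s<x x<ps)
    ... | t , edge′@(t<pt , _) , (s<t , _) , (_ , pt<ps) =
      innermost t (shorter (∸-mono-< s<t (<⇒≤ pt<ps) (<⇒≤ t<pt))) edge′

    innermost-mixed-edge : ¬ (∀ v → Monochromatic v) →
                           Σ[ s ∈ Fin N ] MixedEdge s × MonochromaticInside s
    innermost-mixed-edge not-mono with ¬∀⟶∃¬ N Monochromatic monochromatic? not-mono
    ... | v , mixed with orient (λ _ → ⊤) v mixed tt tt
    ...   | s , edge , _ = innermost s (<-wellFounded _) edge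

module BlockColouring (k : ℕ) .{{_ : NonZero k}} where

  -- After the first p vertices of block b, the colours seen an odd number of times so far are those
  -- below  level (evenᵇ b) p : they climb from c₁ in an odd block and fall from c_k in an even one.
  level : Bool → ℕ → ℕ
  level true p = p
  level false p = k ∸ p

  colour[p+b*k] : ∀ b {p} → p < k → colour k (p + b * k) ≡ (if evenᵇ b then p else k ∸ 1 ∸ p)
  colour[p+b*k] b {p} p<k =
    cong₂ (λ b′ p′ → if evenᵇ b′ then p′ else k ∸ 1 ∸ p′) block≡b pos≡p
    where
    block≡b : (p + b * k) / k ≡ b
    block≡b = trans (+-distrib-/-∣ʳ p (n∣m*n b)) (cong₂ _+_ (m<n⇒m/n≡0 p<k) (m*n/n≡m b k))
    pos≡p : (p + b * k) % k ≡ p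
    pos≡p = trans ([m+kn]%n≡m%n p b k) (m<n⇒m%n≡m p<k)

  level-suc : ∀ e c {p} → p < k →
    (c <ᵇ level e p) xor ((if e then p else k ∸ 1 ∸ p) ≡ᵇ c) ≡ (c <ᵇ level e (suc p))
  level-suc true c {p} _ = sym (<ᵇ-suc c p)
  level-suc false c {p} p<k = begin
    (c <ᵇ k ∸ p) xor (k ∸ 1 ∸ p ≡ᵇ c)        ≡⟨ cong₂ (λ l m → (c <ᵇ l) xor (m ≡ᵇ c))
                                                     (∸-suc p<k) (∸-+-assoc k 1 p) ⟩
    (c <ᵇ suc m) xor (m ≡ᵇ c)                ≡⟨ cong (_xor (m ≡ᵇ c)) (<ᵇ-suc c m) ⟩
    ((c <ᵇ m) xor (m ≡ᵇ c)) xor (m ≡ᵇ c)     ≡⟨ xor-cancelʳ _ _ ⟩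
    (c <ᵇ m)                                 ∎
    where
    open ≡-Reasoning
    m : ℕ
    m = k ∸ suc p

  level-wrap : ∀ b → level (evenᵇ b) k ≡ level (evenᵇ (suc b)) 0
  level-wrap b rewrite evenᵇ-suc b with evenᵇ b
  ... | true = refl
  ... | false = n∸n≡0 k

  oddCountᵇ[p+b*k] : ∀ c b {p} → p ≤ k →
                     oddCountᵇ (colour k) c (p + b * k) ≡ (c <ᵇ level (evenᵇ b) p)
  oddCountᵇ[p+b*k] c zero {zero} _ = refl
  oddCountᵇ[p+b*k] c (suc b) {zero} _ =
    trans (oddCountᵇ[p+b*k] c b ≤-refl) (cong (c <ᵇ_) (level-wrap b))
  oddCountᵇ[p+b*k] c b {suc p} p<k =
    trans (cong₂ _xor_ (oddCountᵇ[p+b*k] c b (<⇒≤ p<k)) (cong (_≡ᵇ c) (colour[p+b*k] b p<k)))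
          (level-suc (evenᵇ b) c p<k)

  levels-agree : ∀ eS eE {ps pe} → ps < k → pe < k → level eS (suc ps) ≡ level eE pe →
    (if eS then ps else k ∸ 1 ∸ ps) ≢ (if eE then pe else k ∸ 1 ∸ pe) →
    eS ≡ eE × pe ≡ suc ps
  levels-agree true true _ _ same _ = refl , sym same
  levels-agree false false ps<k pe<k same _ = refl , ∸-cancelˡ-≡ (<⇒≤ pe<k) ps<k (sym same)
  levels-agree true false {ps} {pe} _ _ same different = ⊥-elim (different (begin
    ps                  ≡⟨ cong pred same ⟩
    pred (k ∸ pe)       ≡⟨ pred[m∸n]≡m∸[1+n] k pe ⟩
    k ∸ suc pe          ≡⟨ ∸-+-assoc k 1 pe ⟨
    k ∸ 1 ∸ pe          ∎))
    where open ≡-Reasoning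
  levels-agree false true {ps} _ _ same different = ⊥-elim (different (trans (∸-+-assoc k 1 ps) same))

  module InnermostEdge {N : ℕ} (M : PerfectMatching N) (plane : Plane M)
                       (valid : ValidBlockStructure k M) where
    open PlaneMatching M plane
    open Colouring (colour k)

    edge-leaves-block : ∀ {s} → Out1 M s → block k (toℕ s) ≢ block k (toℕ (partner M s))
    edge-leaves-block {s} s<e same-block = <-asym s<e
      (subst (λ y → toℕ (partner M s) < toℕ y) (involutive M s) (valid s _ same-block s<e s<e))

    innermost-levels-agree : ∀ {s} → Out1 M s → MonochromaticInside s →
      level (evenᵇ (block k (toℕ s))) (suc (pos k (toℕ s)))
        ≡ level (evenᵇ (block k (toℕ (partner M s)))) (pos k (toℕ (partner M s)))
    innermost-levels-agree {s} s<e inside = <ᵇ-injective λ c → begin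
      c <ᵇ level (evenᵇ bS) (suc ps)           ≡⟨ oddCountᵇ[p+b*k] c bS (m%n<n (toℕ s) k) ⟨
      oddCountᵇ (colour k) c (suc ps + bS * k) ≡⟨ cong (oddCountᵇ (colour k) c ∘ suc)
                                                       (m≡m%n+[m/n]*n (toℕ s) k) ⟨
      oddCountᵇ (colour k) c (suc (toℕ s))     ≡⟨ oddCountᵇ-closed c (<-wellFounded _) s<e
                                                                   (<⇒≤ (toℕ<n e)) closed ⟩
      oddCountᵇ (colour k) c (toℕ e)           ≡⟨ cong (oddCountᵇ (colour k) c)
                                                       (m≡m%n+[m/n]*n (toℕ e) k) ⟩
      oddCountᵇ (colour k) c (pe + bE * k)     ≡⟨ oddCountᵇ[p+b*k] c bE (<⇒≤ (m%n<n (toℕ e) k)) ⟩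
      c <ᵇ level (evenᵇ bE) pe                 ∎
      where
      open ≡-Reasoning
      e : Fin N
      e = partner M s
      bS bE ps pe : ℕ
      bS = block k (toℕ s)
      bE = block k (toℕ e)
      ps = pos k (toℕ s)
      pe = pos k (toℕ e)

      closed : ClosedMonochromatic (suc (toℕ s)) (toℕ e)
      closed x s<x x<e with nested s<e s<x x<e
      ... | s<px , px<e = s<px , px<e , inside x s<x x<e

    innermost-mixed-edge-shape : ∀ {s} → MixedEdge s → MonochromaticInside s →
      block k (toℕ s) ≢ block k (toℕ (partner M s))
      × Odd (block k (toℕ (partner M s)) ∸ block k (toℕ s) ∸ 1)
      × pos k (toℕ (partner M s)) ≡ suc (pos k (toℕ s))
    innermost-mixed-edge-shape {s} (s<e , mixed) inside
      with levels-agree _ _ (m%n<n (toℕ s) k) (m%n<n (toℕ (partner M s)) k)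
                        (innermost-levels-agree s<e inside) mixed
    ... | same-parity , pos-next = leaves , odd-gap blocks-increase same-parity , pos-next
      where
      leaves : block k (toℕ s) ≢ block k (toℕ (partner M s))
      leaves = edge-leaves-block s<e
      blocks-increase : block k (toℕ s) < block k (toℕ (partner M s))
      blocks-increase = ≤∧≢⇒< (/-monoˡ-≤ k (<⇒≤ s<e)) leaves

lemma1 : (k n : ℕ) .{{_ : NonZero k}} → 2 ≤ k → 1 ≤ n → k ∣ n →
    (M : PerfectMatching (2 * n)) → Plane M → ValidBlockStructure k M → ¬ KColoured k M →
    Σ[ s ∈ Fin (2 * n) ] Σ[ e ∈ Fin (2 * n) ]
      (toℕ s < toℕ e × partner M s ≡ e
      × block k (toℕ s) ≢ block k (toℕ e)
      × (∀ x → toℕ s < toℕ x → toℕ x < toℕ e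
             → toℕ s < toℕ (partner M x) → toℕ (partner M x) < toℕ e
             → colour k (toℕ x) ≡ colour k (toℕ (partner M x)))
      × Odd (block k (toℕ e) ∸ block k (toℕ s) ∸ 1)
      × pos k (toℕ e) ≡ suc (pos k (toℕ s)))
lemma1 k n _ _ _ M plane valid not-coloured
  with PlaneMatching.Colouring.innermost-mixed-edge M plane (colour k) not-coloured
... | s , edge@(s<e , _) , inside
  with BlockColouring.InnermostEdge.innermost-mixed-edge-shape k M plane valid edge inside
... | leaves , odd , pos-next =
  s , partner M s , s<e , refl , leaves , (λ x s<x x<e _ _ → inside x s<x x<e) , odd , pos-next
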